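{- For $r=1,2$ let $G_r$ be a graph with Hamilton cycle $H_r$ and auxiliary graph $A_r=A(G_r,H_r)$, and let $S_r\subseteq A_r$ be a disjoint union of colour-alternating cycles without neighbouring vertices. Suppose there is a bijection $V(S_1)\to V(S_2)$ that is an isomorphism of $2$-edge-coloured graphs from $S_1$ to $S_2$ and preserves the order of vertices (i.e. of the edges of $H_1$, respectively $H_2$, along the Hamilton cycle labelling). Then $F(S_1)$ and $F(S_2)$ consist of the same number of cycles.
   Context: For a graph $G$ on $n$ vertices with Hamilton cycle $H=v_1v_2\dots v_nv_1$ (indices mod $n$), write $e_i=v_iv_{i+1}$; an inner edge is an edge of $G$ not in $H$. The auxiliary graph $A(G,H)$ is the $2$-edge-coloured graph on $\{e_1,\dots,e_n\}$, ordered $e_1<\dots<e_n$, with a red edge $e_ie_j$ iff $v_{i+1}v_{j+1}$ is an inner edge of $G$ and a blue edge $e_ie_j$ iff $v_iv_j$ is an inner edge (a pair may get both colours). For a red edge $\ell=e_ie_j$ put $e(\ell)=v_{i+1}v_{j+1}$; for a blue one $e(\ell)=v_iv_j$. A subgraph $S$ of $A$ is a disjoint union of colour-alternating cycles if every vertex of $S$ is incident in $S$ to exactly one red and one blue edge of $S$; it has no neighbouring vertices if no two of its vertices are $e_i,e_{i+1}$ (indices mod $n$). Then $F(S)$ is the spanning subgraph of $G$ with edge set $(\{e_1,\dots,e_n\}\setminus V(S))\cup\{e(\ell):\ell\in E(S)\}$, which is a $2$-factor (spanning $2$-regular subgraph) of $G$. -}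

module Defs where

open import Data.Nat using (ℕ; zero; suc; _≤_)
open import Data.Nat.DivMod using (_mod_)
open import Data.Fin using (Fin; toℕ; _<_)
open import Data.Bool using (Bool; T; false)
open import Data.Product using (Σ; ∃; _×_; _,_)
open import Data.Sum using (_⊎_)
open import Data.Empty using (⊥)
open import Relation.Nullary using (¬_)
open import Relation.Binary.PropositionalEquality using (_≡_)
open import Relation.Binary.Construct.Closure.ReflexiveTransitive using (Star)
open import Function.Bundles using (_⇔_)
open import Function.Definitions using (Injective; Surjective)

next : ∀ {n} → Fin n → Fin n
next {suc m} i = suc (toℕ i) mod suc m

record Graph (n : ℕ) : Set where
  field
    adj    : Fin n → Fin n → Bool
    sym    : ∀ x y → adj x y ≡ adj y x
    irrefl : ∀ x → adj x x ≡ false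

record HamCycle {n : ℕ} (G : Graph n) : Set where
  open Graph G
  field
    v      : Fin n → Fin n
    v-inj  : Injective _≡_ _≡_ v
    v-surj : Surjective _≡_ _≡_ v
    3≤n    : 3 ≤ n
    cyc    : ∀ i → T (adj (v i) (v (next i)))

SameEdge : ∀ {n} → Fin n → Fin n → Fin n → Fin n → Set
SameEdge x y a b = (x ≡ a × y ≡ b) ⊎ (x ≡ b × y ≡ a)

module _ {n : ℕ} {G : Graph n} (H : HamCycle G) where
  open Graph G
  open HamCycle H

  IsHEdge : Fin n → Fin n → Set
  IsHEdge x y = ∃ λ i → SameEdge x y (v i) (v (next i))

  Inner : Fin n → Fin n → Set
  Inner x y = T (adj x y) × ¬ IsHEdge x y

  -- Auxiliary graph A(G,H) on {e_i} (identified with indices i : Fin n,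
  -- ordered by the order of Fin n).
  RedA : Fin n → Fin n → Set
  RedA i j = Inner (v (next i)) (v (next j))

  BlueA : Fin n → Fin n → Set
  BlueA i j = Inner (v i) (v j)

record AltCycles {n : ℕ} {G : Graph n} (H : HamCycle G) : Set where
  field
    inS      : Fin n → Bool
    red      : Fin n → Fin n → Bool
    blue     : Fin n → Fin n → Bool
    red-sym  : ∀ i j → red i j ≡ red j i
    blue-sym : ∀ i j → blue i j ≡ blue j i
    red-sub  : ∀ i j → T (red i j) → RedA H i j
    blue-sub : ∀ i j → T (blue i j) → BlueA H i j
    red-in   : ∀ i j → T (red i j) → T (inS i)
    blue-in  : ∀ i j → T (blue i j) → T (inS i)
    red-deg  : ∀ i → T (inS i) → Σ (Fin n) λ j → T (red i j) × (∀ k → T (red i k) → k ≡ j)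
    blue-deg : ∀ i → T (inS i) → Σ (Fin n) λ j → T (blue i j) × (∀ k → T (blue i k) → k ≡ j)
    noNbr    : ∀ i → T (inS i) → T (inS (next i)) → ⊥

FEdge : ∀ {n} {G : Graph n} {H : HamCycle G} → AltCycles H → Fin n → Fin n → Set
FEdge {n} {G} {H} S x y =
    (∃ λ i → ¬ T (inS i) × SameEdge x y (v i) (v (next i)))
  ⊎ (∃ λ i → ∃ λ j → T (red i j) × SameEdge x y (v (next i)) (v (next j)))
  ⊎ (∃ λ i → ∃ λ j → T (blue i j) × SameEdge x y (v i) (v j))
  where
  open HamCycle H
  open AltCycles S

-- A graph with edge relation E on Fin n has exactly k connected components
-- (for a 2-factor: consists of exactly k cycles): there is a surjective
-- labelling of the vertices by Fin k whose fibres are the components.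
HasComponents : ∀ {n} → (Fin n → Fin n → Set) → ℕ → Set
HasComponents {n} E k =
  Σ (Fin n → Fin k) λ c → Surjective _≡_ _≡_ c × (∀ x y → (c x ≡ c y) ⇔ Star E x y)

-- The bijection φ : V(S₁) → V(S₂) (given as a map Fin n₁ → Fin n₂, only its
-- values on V(S₁) matter) is an order-preserving isomorphism of
-- 2-edge-coloured graphs from S₁ to S₂.
record OrderIso {n₁ n₂ : ℕ} {G₁ : Graph n₁} {H₁ : HamCycle G₁}
                {G₂ : Graph n₂} {H₂ : HamCycle G₂}
                (S₁ : AltCycles H₁) (S₂ : AltCycles H₂) (φ : Fin n₁ → Fin n₂) : Set where
  private
    module S₁ = AltCycles S₁
    module S₂ = AltCycles S₂
  field
    maps-into : ∀ i → T (S₁.inS i) → T (S₂.inS (φ i))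
    onto      : ∀ j → T (S₂.inS j) → Σ (Fin n₁) λ i → T (S₁.inS i) × φ i ≡ j
    injective : ∀ i j → T (S₁.inS i) → T (S₁.inS j) → φ i ≡ φ j → i ≡ j
    order     : ∀ i j → T (S₁.inS i) → T (S₁.inS j) → (i < j) ⇔ (φ i < φ j)
    red-pres  : ∀ i j → T (S₁.inS i) → T (S₁.inS j) → S₁.red i j ≡ S₂.red (φ i) (φ j)
    blue-pres : ∀ i j → T (S₁.inS i) → T (S₁.inS j) → S₁.blue i j ≡ S₂.blue (φ i) (φ j)

module Submission where

-- Walking along H from any vertex stays inside one cycle of F(S) until it reaches an edge
-- e_k ∈ V(S), so every cycle of F(S) passes through some v_k with e_k ∈ V(S). Among these
-- vertices a blue edge e_ie_j joins v_i to v_j, and a red edge e_ie_j joins v_{i+1} to v_{j+1},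
-- that is, v_k to v_l where e_k, e_l are the S-vertices cyclically following e_i, e_j.
-- Connectivity in F(S) is thus governed by the colours of S and the cyclic order of V(S), which
-- φ preserves: x ↦ v_{φ(k)}, for e_k the first S-vertex from x on, maps edges of F(S₁) to walks
-- in F(S₂), the same map for φ⁻¹ is inverse to it up to connectivity, and so the components of
-- F(S₁) and F(S₂) correspond.

open import Defs
open import Level using (0ℓ)
open import Data.Nat as ℕ using (ℕ; zero; suc; _+_; z≤n; s≤s)
import Data.Nat.Properties as ℕₚ
open import Data.Nat.DivMod using (m<n⇒m%n≡m; n%n≡0)
open import Data.Fin using (Fin; zero; suc; toℕ; fromℕ; _≤_; _<_)
open import Data.Fin.Properties
  using ( any?; _≟_; suc-injective; toℕ-injective; toℕ-fromℕ<; toℕ-fromℕ; toℕ<n; ≤fromℕ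
        ; ≤-antisym; ≤∧≢⇒<)
open import Data.Bool using (T)
open import Data.Product using (Σ; ∃; _×_; _,_; proj₁; proj₂)
open import Data.Sum using (_⊎_; inj₁; inj₂)
open import Data.Unit using (⊤; tt)
open import Data.Empty using (⊥; ⊥-elim)
open import Function using (_∘_)
open import Function.Bundles using (_⇔_; mk⇔; module Equivalence)
open import Function.Definitions using (Surjective)
open import Relation.Nullary using (¬_; Dec; yes; no; ¬?)
open import Relation.Nullary.Decidable using (_×-dec_; _⊎-dec_; T?)
import Relation.Nullary.Decidable as Dec
open import Relation.Binary.Core using (Rel; _=[_]⇒_)
open import Relation.Binary.Definitions using (Reflexive; Symmetric; Transitive; Decidable)
open import Relation.Binary.PropositionalEquality
  using (_≡_; refl; sym; trans; cong; cong₂; subst; subst₂; module ≡-Reasoning)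
open import Relation.Binary.Construct.Closure.ReflexiveTransitive
  using (Star; ε; _◅_; _◅◅_; reverse; gmap; kleisliStar)
open import Relation.Binary.Construct.Closure.ReflexiveTransitive.Properties using (reflexive)

open Equivalence using (to; from)

-- Connected components of finite graphs

ClassLabelling : ∀ {n} → Rel (Fin n) 0ℓ → ℕ → Set
ClassLabelling {n} R k =
  Σ (Fin n → Fin k) λ c → Surjective _≡_ _≡_ c × (∀ x y → (c x ≡ c y) ⇔ R x y)

classLabelling : ∀ {n} {R : Rel (Fin n) 0ℓ} →
  Decidable R → Reflexive R → Symmetric R → Transitive R → ∃ (ClassLabelling R)
classLabelling {zero} _ _ _ _ = 0 , (λ ()) , (λ ()) , (λ ())
classLabelling {suc n} {R} R? R-refl R-sym R-trans
  with classLabelling (λ i j → R? (suc i) (suc j)) R-refl R-sym R-trans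
     | any? (λ j → R? zero (suc j))
... | k , c , c-surj , c-classes | yes (j₀ , R0j₀) = k , c′ , c′-surj , c′-classes
  where
  c′ : Fin (suc n) → Fin k
  c′ zero = c j₀
  c′ (suc j) = c j
  c′-surj : Surjective _≡_ _≡_ c′
  c′-surj l with c-surj l
  ... | x , h = suc x , λ { refl → h refl }
  c′-classes : ∀ x y → (c′ x ≡ c′ y) ⇔ R x y
  c′-classes zero zero = mk⇔ (λ _ → R-refl) (λ _ → refl)
  c′-classes zero (suc y) =
    mk⇔ (R-trans R0j₀ ∘ to (c-classes j₀ y)) (from (c-classes j₀ y) ∘ R-trans (R-sym R0j₀))
  c′-classes (suc x) zero =
    mk⇔ ((λ Rxj₀ → R-trans Rxj₀ (R-sym R0j₀)) ∘ to (c-classes x j₀))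
        (λ Rx0 → from (c-classes x j₀) (R-trans Rx0 R0j₀))
  c′-classes (suc x) (suc y) = c-classes x y
... | k , c , c-surj , c-classes | no ¬R0 = suc k , c′ , c′-surj , c′-classes
  where
  c′ : Fin (suc n) → Fin (suc k)
  c′ zero = zero
  c′ (suc j) = suc (c j)
  c′-surj : Surjective _≡_ _≡_ c′
  c′-surj zero = zero , λ { refl → refl }
  c′-surj (suc l) with c-surj l
  ... | x , h = suc x , λ { refl → cong suc (h refl) }
  c′-classes : ∀ x y → (c′ x ≡ c′ y) ⇔ R x y
  c′-classes zero zero = mk⇔ (λ _ → R-refl) (λ _ → refl)
  c′-classes zero (suc y) = mk⇔ (λ ()) (λ R0y → ⊥-elim (¬R0 (y , R0y)))
  c′-classes (suc x) zero = mk⇔ (λ ()) (λ Rx0 → ⊥-elim (¬R0 (x , R-sym Rx0)))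
  c′-classes (suc x) (suc y) = mk⇔ (to (c-classes x y) ∘ suc-injective) (cong suc ∘ from (c-classes x y))

-- A walk either avoids vertex zero, or splits into two walks to zero that avoid it before arriving.
module ReachabilityThroughZero {n} (E : Rel (Fin (suc n)) 0ℓ) (E-sym : Symmetric E) where

  E⁻ : Rel (Fin n) 0ℓ
  E⁻ i j = E (suc i) (suc j)

  ReachesZero : Fin (suc n) → Set
  ReachesZero zero = ⊤
  ReachesZero (suc x) = ∃ λ a → Star E⁻ x a × E (suc a) zero

  AvoidsZero : Rel (Fin (suc n)) 0ℓ
  AvoidsZero (suc x) (suc y) = Star E⁻ x y
  AvoidsZero _ _ = ⊥

  Reach : Rel (Fin (suc n)) 0ℓ
  Reach u w = AvoidsZero u w ⊎ (ReachesZero u × ReachesZero w)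

  lift : ∀ {x y} → Star E⁻ x y → Star E (suc x) (suc y)
  lift = gmap suc (λ e → e)

  ReachesZero⇒Star : ∀ u → ReachesZero u → Star E u zero
  ReachesZero⇒Star zero _ = ε
  ReachesZero⇒Star (suc x) (a , p , e) = lift p ◅◅ (e ◅ ε)

  Reach⇒Star : ∀ u w → Reach u w → Star E u w
  Reach⇒Star (suc x) (suc y) (inj₁ p) = lift p
  Reach⇒Star u w (inj₂ (u→0 , w→0)) = ReachesZero⇒Star u u→0 ◅◅ reverse E-sym (ReachesZero⇒Star w w→0)

  Reach-◅ : ∀ u w z → E u w → Reach w z → Reach u z
  Reach-◅ zero (suc w) (suc z) e (inj₁ p) = inj₂ (tt , (w , reverse E-sym p , E-sym e))
  Reach-◅ zero w z e (inj₂ (_ , z→0)) = inj₂ (tt , z→0)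
  Reach-◅ (suc u) zero z e (inj₂ (_ , z→0)) = inj₂ ((u , ε , e) , z→0)
  Reach-◅ (suc u) (suc w) (suc z) e (inj₁ p) = inj₁ (e ◅ p)
  Reach-◅ (suc u) (suc w) z e (inj₂ ((a , p , e′) , z→0)) = inj₂ ((a , e ◅ p , e′) , z→0)

  Star⇒Reach : ∀ {u w} → Star E u w → Reach u w
  Star⇒Reach {zero} ε = inj₂ (tt , tt)
  Star⇒Reach {suc x} ε = inj₁ ε
  Star⇒Reach {u} {w} (_◅_ {j = t} e p) = Reach-◅ u t w e (Star⇒Reach p)

  Reach? : Decidable E → Decidable (Star E⁻) → Decidable Reach
  Reach? E? E⁻*? u w = AvoidsZero? u w ⊎-dec (ReachesZero? u ×-dec ReachesZero? w)
    where
    AvoidsZero? : Decidable AvoidsZero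
    AvoidsZero? zero _ = no λ ()
    AvoidsZero? (suc x) zero = no λ ()
    AvoidsZero? (suc x) (suc y) = E⁻*? x y
    ReachesZero? : ∀ u → Dec (ReachesZero u)
    ReachesZero? zero = yes tt
    ReachesZero? (suc x) = any? (λ a → E⁻*? x a ×-dec E? (suc a) zero)

Star? : ∀ {n} {E : Rel (Fin n) 0ℓ} → Decidable E → Symmetric E → Decidable (Star E)
Star? {zero} _ _ ()
Star? {suc n} {E} E? E-sym u w =
  Dec.map (mk⇔ (Reach⇒Star u w) Star⇒Reach) (Reach? E? (Star? (λ x y → E? (suc x) (suc y)) E-sym) u w)
  where open ReachabilityThroughZero E E-sym

components : ∀ {n} {E : Rel (Fin n) 0ℓ} → Decidable E → Symmetric E → ∃ (HasComponents E)
components E? E-sym = classLabelling (Star? E? E-sym) ε (reverse E-sym) _◅◅_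

HasComponents-transfer : ∀ {n₁ n₂} {E₁ : Rel (Fin n₁) 0ℓ} {E₂ : Rel (Fin n₂) 0ℓ} → Symmetric E₂ →
  (f : Fin n₁ → Fin n₂) (g : Fin n₂ → Fin n₁) → E₁ =[ f ]⇒ Star E₂ → E₂ =[ g ]⇒ Star E₁ →
  (∀ x → Star E₁ (g (f x)) x) → (∀ y → Star E₂ (f (g y)) y) →
  ∀ {k} → HasComponents E₁ k → HasComponents E₂ k
HasComponents-transfer {E₁ = E₁} {E₂} E₂-sym f g f-hom g-hom gf fg (c , c-surj , c-classes) =
  c ∘ g , surj , classes
  where
  surj : Surjective _≡_ _≡_ (c ∘ g)
  surj l with c-surj l
  ... | x , h = f x , λ { refl → trans (from (c-classes (g (f x)) x) (gf x)) (h refl) }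
  classes : ∀ x y → (c (g x) ≡ c (g y)) ⇔ Star E₂ x y
  classes x y = mk⇔
    (λ eq → reverse E₂-sym (fg x) ◅◅ kleisliStar f f-hom (to (c-classes (g x) (g y)) eq) ◅◅ fg y)
    (from (c-classes (g x) (g y)) ∘ kleisliStar g g-hom)

-- Cyclic order on Fin (suc m)

IsLeast : ∀ {n} → (Fin n → Set) → Fin n → Set
IsLeast Q e = Q e × (∀ k → Q k → e ≤ k)

IsLeast-unique : ∀ {n} {Q : Fin n → Set} {e e′} → IsLeast Q e → IsLeast Q e′ → e ≡ e′
IsLeast-unique (qe , e-min) (qe′ , e′-min) = ≤-antisym (e-min _ qe′) (e′-min _ qe)

least : ∀ {n} {Q : Fin n → Set} → (∀ k → Dec (Q k)) → (∀ k → ¬ Q k) ⊎ ∃ (IsLeast Q)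
least {zero} Q? = inj₁ λ ()
least {suc n} Q? with Q? zero
... | yes q0 = inj₂ (zero , q0 , λ _ _ → z≤n)
... | no ¬q0 with least (Q? ∘ suc)
...   | inj₁ none = inj₁ λ { zero → ¬q0 ; (suc k) → none k }
...   | inj₂ (e , qe , e-min) =
  inj₂ (suc e , qe , λ { zero q0 → ⊥-elim (¬q0 q0) ; (suc k) qk → s≤s (e-min k qk) })

module _ {m : ℕ} where

  toℕ-next : ∀ (i : Fin (suc m)) → toℕ i ℕ.< m → toℕ (next i) ≡ suc (toℕ i)
  toℕ-next i i<m = trans (toℕ-fromℕ< _) (m<n⇒m%n≡m (s≤s i<m))

  next-fromℕ : next (fromℕ m) ≡ zero
  next-fromℕ = toℕ-injective (begin
    toℕ (next (fromℕ m))        ≡⟨ toℕ-fromℕ< _ ⟩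
    suc (toℕ (fromℕ m)) ℕ.% suc m ≡⟨ cong (λ t → suc t ℕ.% suc m) (toℕ-fromℕ m) ⟩
    suc m ℕ.% suc m             ≡⟨ n%n≡0 (suc m) ⟩
    0                           ∎)
    where open ≡-Reasoning

  fromℕ-or-below : ∀ (i : Fin (suc m)) → i ≡ fromℕ m ⊎ toℕ i ℕ.< m
  fromℕ-or-below i with ℕₚ.m≤n⇒m<n∨m≡n (≤fromℕ i)
  ... | inj₁ i<last = inj₂ (subst (toℕ i ℕ.<_) (toℕ-fromℕ m) i<last)
  ... | inj₂ i≡last = inj₁ (toℕ-injective i≡last)

module CyclicOrder {m} (P : Fin (suc m) → Set) where

  -- e is the first element of P met when walking cyclically upwards from position t ≤ suc m.
  FirstFrom : ℕ → Fin (suc m) → Set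
  FirstFrom t e = IsLeast (λ k → P k × t ℕ.≤ toℕ k) e ⊎ ((∀ k → P k → toℕ k ℕ.< t) × IsLeast P e)

  FirstFrom-P : ∀ {t e} → FirstFrom t e → P e
  FirstFrom-P (inj₁ ((pe , _) , _)) = pe
  FirstFrom-P (inj₂ (_ , pe , _)) = pe

  FirstFrom-unique : ∀ {t e e′} → FirstFrom t e → FirstFrom t e′ → e ≡ e′
  FirstFrom-unique (inj₁ first) (inj₁ first′) = IsLeast-unique first first′
  FirstFrom-unique (inj₁ ((pe , t≤e) , _)) (inj₂ (before-t , _)) =
    ⊥-elim (ℕₚ.<⇒≱ (before-t _ pe) t≤e)
  FirstFrom-unique (inj₂ (before-t , _)) (inj₁ ((pe′ , t≤e′) , _)) =
    ⊥-elim (ℕₚ.<⇒≱ (before-t _ pe′) t≤e′)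
  FirstFrom-unique (inj₂ (_ , first)) (inj₂ (_ , first′)) = IsLeast-unique first first′

  firstFrom : ∃ P → (∀ k → Dec (P k)) → ∀ t → ∃ (FirstFrom t)
  firstFrom (s , ps) P? t with least (λ k → P? k ×-dec (t ℕ.≤? toℕ k))
  ... | inj₂ (e , first) = e , inj₁ first
  ... | inj₁ none with least P?
  ...   | inj₂ (e , first) = e , inj₂ ((λ k pk → ℕₚ.≰⇒> (λ t≤k → none k (pk , t≤k))) , first)
  ...   | inj₁ empty = ⊥-elim (empty s ps)

  FirstFrom-skip : ∀ {a e} → ¬ P a → FirstFrom (toℕ a) e → FirstFrom (suc (toℕ a)) e
  FirstFrom-skip ¬pa (inj₁ ((pe , a≤e) , e-min)) =
    inj₁ ((pe , ≤∧≢⇒< a≤e λ { refl → ¬pa pe }) , λ k (pk , a<k) → e-min k (pk , ℕₚ.<⇒≤ a<k))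
  FirstFrom-skip _ (inj₂ (before-a , first)) = inj₂ ((λ k pk → ℕₚ.m<n⇒m<1+n (before-a k pk)) , first)

  FirstFrom-0⇔end : ∀ {e} → FirstFrom 0 e ⇔ FirstFrom (suc m) e
  FirstFrom-0⇔end {e} = mk⇔ to′ from′
    where
    to′ : FirstFrom 0 e → FirstFrom (suc m) e
    to′ (inj₁ ((pe , _) , e-min)) = inj₂ ((λ k _ → toℕ<n k) , pe , λ k pk → e-min k (pk , z≤n))
    to′ (inj₂ (before-0 , pe , _)) = ⊥-elim (ℕₚ.n≮0 (before-0 _ pe))
    from′ : FirstFrom (suc m) e → FirstFrom 0 e
    from′ (inj₁ ((_ , end≤e) , _)) = ⊥-elim (ℕₚ.<⇒≱ (toℕ<n e) end≤e)
    from′ (inj₂ (_ , pe , e-min)) = inj₁ ((pe , z≤n) , λ k (pk , _) → e-min k pk)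

  FirstFrom-next : ∀ i {e} → FirstFrom (toℕ (next i)) e ⇔ FirstFrom (suc (toℕ i)) e
  FirstFrom-next i {e} with fromℕ-or-below i
  ... | inj₁ refl = subst₂ (λ s t → FirstFrom s e ⇔ FirstFrom t e)
                      (cong toℕ (sym next-fromℕ)) (cong suc (sym (toℕ-fromℕ m))) FirstFrom-0⇔end
  ... | inj₂ i<m rewrite toℕ-next i i<m = mk⇔ (λ first → first) (λ first → first)

-- The 2-factor F(S)

SameEdge-swap : ∀ {n} {x y a b : Fin n} → SameEdge x y a b → SameEdge y x a b
SameEdge-swap (inj₁ (x≡a , y≡b)) = inj₂ (y≡b , x≡a)
SameEdge-swap (inj₂ (x≡b , y≡a)) = inj₁ (y≡a , x≡b)

SameEdge? : ∀ {n} (x y a b : Fin n) → Dec (SameEdge x y a b)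
SameEdge? x y a b = ((x ≟ a) ×-dec (y ≟ b)) ⊎-dec ((x ≟ b) ×-dec (y ≟ a))

SameEdge-elim : ∀ {n} {x y a b : Fin n} (R : Rel (Fin n) 0ℓ) →
                Symmetric R → R a b → SameEdge x y a b → R x y
SameEdge-elim R R-sym Rab (inj₁ (refl , refl)) = Rab
SameEdge-elim R R-sym Rab (inj₂ (refl , refl)) = R-sym Rab

module TwoFactor {m} {G : Graph (suc m)} {H : HamCycle G} (S : AltCycles H) where
  open HamCycle H public
  open AltCycles S public
  open CyclicOrder (T ∘ inS) public

  Edge : Rel (Fin (suc m)) 0ℓ
  Edge = FEdge S

  Edge-sym : Symmetric Edge
  Edge-sym (inj₁ (i , i∉S , xy)) = inj₁ (i , i∉S , SameEdge-swap xy)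
  Edge-sym (inj₂ (inj₁ (i , j , r , xy))) = inj₂ (inj₁ (i , j , r , SameEdge-swap xy))
  Edge-sym (inj₂ (inj₂ (i , j , b , xy))) = inj₂ (inj₂ (i , j , b , SameEdge-swap xy))

  Edge? : Decidable Edge
  Edge? x y =
    any? (λ i → ¬? (T? (inS i)) ×-dec SameEdge? x y (v i) (v (next i)))
    ⊎-dec any? (λ i → any? (λ j → T? (red i j) ×-dec SameEdge? x y (v (next i)) (v (next j))))
    ⊎-dec any? (λ i → any? (λ j → T? (blue i j) ×-dec SameEdge? x y (v i) (v j)))

  red-endpoints : ∀ {i j} → T (red i j) → T (inS i) × T (inS j)
  red-endpoints {i} {j} r = red-in i j r , red-in j i (subst T (red-sym i j) r)

  blue-endpoints : ∀ {i j} → T (blue i j) → T (inS i) × T (inS j)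
  blue-endpoints {i} {j} b = blue-in i j b , blue-in j i (subst T (blue-sym i j) b)

  v⁻¹ : Fin (suc m) → Fin (suc m)
  v⁻¹ x = proj₁ (v-surj x)

  v-v⁻¹ : ∀ x → v (v⁻¹ x) ≡ x
  v-v⁻¹ x = proj₂ (v-surj x) refl

  v⁻¹-v : ∀ a → v⁻¹ (v a) ≡ a
  v⁻¹-v a = v-inj (v-v⁻¹ (v a))

  H-edge : ∀ {i} → ¬ T (inS i) → Edge (v i) (v (next i))
  H-edge {i} i∉S = inj₁ (i , i∉S , inj₁ (refl , refl))

  red-edge : ∀ {i j} → T (red i j) → Edge (v (next i)) (v (next j))
  red-edge {i} {j} r = inj₂ (inj₁ (i , j , r , inj₁ (refl , refl)))

  blue-edge : ∀ {i j} → T (blue i j) → Edge (v i) (v j)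
  blue-edge {i} {j} b = inj₂ (inj₂ (i , j , b , inj₁ (refl , refl)))

  H-path : ∀ d {a b} → toℕ b ≡ d + toℕ a →
           (∀ k → a ≤ k → k < b → ¬ T (inS k)) → Star Edge (v a) (v b)
  H-path zero b≡a _ with toℕ-injective b≡a
  ... | refl = ε
  H-path (suc d) {a} {b} b≡1+d+a between∉S =
    H-edge (between∉S a ℕₚ.≤-refl a<b) ◅ H-path d b≡d+next (λ k next≤k → between∉S k (a≤ next≤k))
    where
    a<b : a < b
    a<b = subst (suc (toℕ a) ℕ.≤_) (sym b≡1+d+a) (s≤s (ℕₚ.m≤n+m (toℕ a) d))
    next-a : toℕ (next a) ≡ suc (toℕ a)
    next-a = toℕ-next a (ℕₚ.<-≤-trans a<b (ℕ.s≤s⁻¹ (toℕ<n b)))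
    b≡d+next : toℕ b ≡ d + toℕ (next a)
    b≡d+next = trans b≡1+d+a (trans (sym (ℕₚ.+-suc d (toℕ a))) (cong (d +_) (sym next-a)))
    a≤ : ∀ {k} → next a ≤ k → a ≤ k
    a≤ next≤k = ℕₚ.<⇒≤ (subst (ℕ._≤ _) next-a next≤k)

  H-path-≤ : ∀ {a b} → a ≤ b → (∀ k → a ≤ k → k < b → ¬ T (inS k)) → Star Edge (v a) (v b)
  H-path-≤ a≤b = H-path _ (sym (ℕₚ.m∸n+n≡m a≤b))

  FirstFrom-walk : ∀ {a e} → FirstFrom (toℕ a) e → Star Edge (v a) (v e)
  FirstFrom-walk (inj₁ ((_ , a≤e) , e-min)) =
    H-path-≤ a≤e (λ k a≤k k<e k∈S → ℕₚ.<⇒≱ k<e (e-min k (k∈S , a≤k)))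
  FirstFrom-walk {a} {e} (inj₂ (before-a , _ , e-min)) =
    H-path-≤ (≤fromℕ a) (λ k a≤k _ k∈S → ℕₚ.<⇒≱ (before-a k k∈S) a≤k)
    ◅◅ H-edge (λ last∈S → ℕₚ.<⇒≱ (before-a _ last∈S) (≤fromℕ a))
    ◅ subst (λ z → Star Edge (v z) (v e)) (sym next-fromℕ)
        (H-path-≤ z≤n (λ k _ k<e k∈S → ℕₚ.<⇒≱ k<e (e-min k k∈S)))

  connected-if-S-empty : (∀ k → ¬ T (inS k)) → HasComponents Edge 1
  connected-if-S-empty S-empty =
    (λ _ → zero) , (λ { zero → zero , λ _ → refl }) ,
    λ x y → mk⇔ (λ _ → reverse Edge-sym (from-v₀ x) ◅◅ from-v₀ y) (λ _ → refl)
    where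
    from-v₀ : ∀ x → Star Edge (v zero) x
    from-v₀ x = subst (Star Edge (v zero)) (v-v⁻¹ x) (H-path-≤ z≤n (λ k _ _ → S-empty k))

  module Nonempty (S-nonempty : ∃ (T ∘ inS)) where

    first : Fin (suc m) → Fin (suc m)
    first a = proj₁ (firstFrom S-nonempty (T? ∘ inS) (toℕ a))

    first-FirstFrom : ∀ a → FirstFrom (toℕ a) (first a)
    first-FirstFrom a = proj₂ (firstFrom S-nonempty (T? ∘ inS) (toℕ a))

    first-inS : ∀ a → T (inS (first a))
    first-inS a = FirstFrom-P (first-FirstFrom a)

    first-fixes-S : ∀ {e} → T (inS e) → first e ≡ e
    first-fixes-S {e} e∈S =
      FirstFrom-unique (first-FirstFrom e) (inj₁ ((e∈S , ℕₚ.≤-refl) , λ k (_ , e≤k) → e≤k))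

    first-next : ∀ {i} → ¬ T (inS i) → first i ≡ first (next i)
    first-next {i} i∉S = FirstFrom-unique
      (from (FirstFrom-next i) (FirstFrom-skip i∉S (first-FirstFrom i))) (first-FirstFrom (next i))

    first-after : ∀ i → FirstFrom (suc (toℕ i)) (first (next i))
    first-after i = to (FirstFrom-next i) (first-FirstFrom (next i))

    firstᵛ : Fin (suc m) → Fin (suc m)
    firstᵛ x = first (v⁻¹ x)

    walk-to-firstᵛ : ∀ x → Star Edge x (v (firstᵛ x))
    walk-to-firstᵛ x =
      subst (λ y → Star Edge y (v (firstᵛ x))) (v-v⁻¹ x) (FirstFrom-walk (first-FirstFrom (v⁻¹ x)))

-- Comparing F(S₁) and F(S₂)

module Transport {m₁ m₂} {G₁ : Graph (suc m₁)} {H₁ : HamCycle G₁}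
                 {G₂ : Graph (suc m₂)} {H₂ : HamCycle G₂}
                 {S₁ : AltCycles H₁} {S₂ : AltCycles H₂} {φ : Fin (suc m₁) → Fin (suc m₂)}
                 (iso : OrderIso S₁ S₂ φ) (S₁-nonempty : ∃ (T ∘ AltCycles.inS S₁)) where
  open OrderIso iso
  module F₁ = TwoFactor S₁
  module F₂ = TwoFactor S₂
  module N₁ = F₁.Nonempty S₁-nonempty
  module N₂ = F₂.Nonempty (φ (proj₁ S₁-nonempty) , maps-into _ (proj₂ S₁-nonempty))

  ∀-onto : ∀ {Q : Fin (suc m₂) → Set} →
           (∀ k → T (F₁.inS k) → Q (φ k)) → ∀ k′ → T (F₂.inS k′) → Q k′
  ∀-onto h k′ k′∈S with onto k′ k′∈S
  ... | k , k∈S , refl = h k k∈S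

  φ-mono-≤ : ∀ {i j} → T (F₁.inS i) → T (F₁.inS j) → i ≤ j → φ i ≤ φ j
  φ-mono-≤ i∈S j∈S i≤j = ℕₚ.≮⇒≥ (λ φj<φi → ℕₚ.≤⇒≯ i≤j (from (order _ _ j∈S i∈S) φj<φi))

  FirstFrom-suc-φ : ∀ {i e} → T (F₁.inS i) →
                    F₁.FirstFrom (suc (toℕ i)) e → F₂.FirstFrom (suc (toℕ (φ i))) (φ e)
  FirstFrom-suc-φ {i} {e} i∈S (inj₁ ((e∈S , i<e) , e-min)) =
    inj₁ ((maps-into e e∈S , to (order i e i∈S e∈S) i<e) , λ k′ (k′∈S , φi<k′) → φe-min k′ k′∈S φi<k′)
    where
    φe-min : ∀ k′ → T (F₂.inS k′) → φ i < k′ → φ e ≤ k′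
    φe-min = ∀-onto λ k k∈S φi<φk → φ-mono-≤ e∈S k∈S (e-min k (k∈S , from (order i k i∈S k∈S) φi<φk))
  FirstFrom-suc-φ {i} {e} i∈S (inj₂ (up-to-i , e∈S , e-min)) =
    inj₂ ((∀-onto λ k k∈S → s≤s (φ-mono-≤ k∈S i∈S (ℕ.s≤s⁻¹ (up-to-i k k∈S)))) ,
          maps-into e e∈S , ∀-onto λ k k∈S → φ-mono-≤ e∈S k∈S (e-min k k∈S))

  f : Fin (suc m₁) → Fin (suc m₂)
  f x = F₂.v (φ (N₁.firstᵛ x))

  f-v : ∀ a → f (F₁.v a) ≡ F₂.v (φ (N₁.first a))
  f-v a = cong (λ b → F₂.v (φ (N₁.first b))) (F₁.v⁻¹-v a)

  f-S : ∀ {e} → T (F₁.inS e) → f (F₁.v e) ≡ F₂.v (φ e)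
  f-S e∈S = trans (f-v _) (cong (F₂.v ∘ φ) (N₁.first-fixes-S e∈S))

  f-skip : ∀ {i} → ¬ T (F₁.inS i) → f (F₁.v i) ≡ f (F₁.v (next i))
  f-skip {i} i∉S = trans (f-v i) (trans (cong (F₂.v ∘ φ) (N₁.first-next i∉S)) (sym (f-v (next i))))

  f-next : ∀ {i} → T (F₁.inS i) → f (F₁.v (next i)) ≡ F₂.v (N₂.first (next (φ i)))
  f-next {i} i∈S = trans (f-v (next i))
    (cong F₂.v (F₂.FirstFrom-unique (FirstFrom-suc-φ i∈S (N₁.first-after i)) (N₂.first-after (φ i))))

  f-after : ∀ {i} → T (F₁.inS i) → Star F₂.Edge (f (F₁.v (next i))) (F₂.v (next (φ i)))
  f-after {i} i∈S = subst (λ x → Star F₂.Edge x (F₂.v (next (φ i)))) (sym (f-next i∈S))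
                          (reverse F₂.Edge-sym (F₂.FirstFrom-walk (N₂.first-FirstFrom (next (φ i)))))

  ImageConnected : Rel (Fin (suc m₁)) 0ℓ
  ImageConnected x y = Star F₂.Edge (f x) (f y)

  f-hom : F₁.Edge =[ f ]⇒ Star F₂.Edge
  f-hom (inj₁ (i , i∉S , xy)) = SameEdge-elim ImageConnected (reverse F₂.Edge-sym)
    (reflexive F₂.Edge (f-skip i∉S)) xy
  f-hom (inj₂ (inj₁ (i , j , r , xy))) = SameEdge-elim ImageConnected (reverse F₂.Edge-sym)
    (f-after i∈S ◅◅ F₂.red-edge r′ ◅ reverse F₂.Edge-sym (f-after j∈S)) xy
    where
    i∈S : T (F₁.inS i)
    i∈S = proj₁ (F₁.red-endpoints r)
    j∈S : T (F₁.inS j)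
    j∈S = proj₂ (F₁.red-endpoints r)
    r′ : T (F₂.red (φ i) (φ j))
    r′ = subst T (red-pres i j i∈S j∈S) r
  f-hom (inj₂ (inj₂ (i , j , b , xy))) = SameEdge-elim ImageConnected (reverse F₂.Edge-sym)
    (subst₂ (Star F₂.Edge) (sym (f-S i∈S)) (sym (f-S j∈S)) (F₂.blue-edge b′ ◅ ε)) xy
    where
    i∈S : T (F₁.inS i)
    i∈S = proj₁ (F₁.blue-endpoints b)
    j∈S : T (F₁.inS j)
    j∈S = proj₂ (F₁.blue-endpoints b)
    b′ : T (F₂.blue (φ i) (φ j))
    b′ = subst T (blue-pres i j i∈S j∈S) b

module Inverse {n₁ n₂} {G₁ : Graph n₁} {H₁ : HamCycle G₁} {G₂ : Graph n₂} {H₂ : HamCycle G₂}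
               {S₁ : AltCycles H₁} {S₂ : AltCycles H₂} {φ : Fin n₁ → Fin n₂}
               (iso : OrderIso S₁ S₂ φ) (default : Fin n₁) where
  open OrderIso iso
  private
    module A₁ = AltCycles S₁
    module A₂ = AltCycles S₂

  ψ : Fin n₂ → Fin n₁
  ψ j with T? (A₂.inS j)
  ... | yes j∈S = proj₁ (onto j j∈S)
  ... | no _ = default

  ψ-spec : ∀ j → T (A₂.inS j) → T (A₁.inS (ψ j)) × φ (ψ j) ≡ j
  ψ-spec j j∈S with T? (A₂.inS j)
  ... | yes j∈S′ = proj₂ (onto j j∈S′)
  ... | no j∉S = ⊥-elim (j∉S j∈S)

  ψ-maps-into : ∀ j → T (A₂.inS j) → T (A₁.inS (ψ j))
  ψ-maps-into j j∈S = proj₁ (ψ-spec j j∈S)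

  φ∘ψ : ∀ j → T (A₂.inS j) → φ (ψ j) ≡ j
  φ∘ψ j j∈S = proj₂ (ψ-spec j j∈S)

  ψ∘φ : ∀ i → T (A₁.inS i) → ψ (φ i) ≡ i
  ψ∘φ i i∈S = injective _ _ (ψ-maps-into (φ i) φi∈S) i∈S (φ∘ψ (φ i) φi∈S)
    where
    φi∈S : T (A₂.inS (φ i))
    φi∈S = maps-into i i∈S

  inverse : OrderIso S₂ S₁ ψ
  inverse = record
    { maps-into = ψ-maps-into
    ; onto = λ i i∈S → φ i , maps-into i i∈S , ψ∘φ i i∈S
    ; injective = λ j j′ j∈S j′∈S ψj≡ψj′ →
        trans (sym (φ∘ψ j j∈S)) (trans (cong φ ψj≡ψj′) (φ∘ψ j′ j′∈S))
    ; order = λ j j′ j∈S j′∈S →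
        let φψ = φ∘ψ j j∈S ; φψ′ = φ∘ψ j′ j′∈S
            ψ-order = order (ψ j) (ψ j′) (ψ-maps-into j j∈S) (ψ-maps-into j′ j′∈S)
        in mk⇔ (from ψ-order ∘ subst₂ _<_ (sym φψ) (sym φψ′)) (subst₂ _<_ φψ φψ′ ∘ to ψ-order)
    ; red-pres = λ j j′ j∈S j′∈S →
        trans (cong₂ A₂.red (sym (φ∘ψ j j∈S)) (sym (φ∘ψ j′ j′∈S)))
              (sym (red-pres (ψ j) (ψ j′) (ψ-maps-into j j∈S) (ψ-maps-into j′ j′∈S)))
    ; blue-pres = λ j j′ j∈S j′∈S →
        trans (cong₂ A₂.blue (sym (φ∘ψ j j∈S)) (sym (φ∘ψ j′ j′∈S)))
              (sym (blue-pres (ψ j) (ψ j′) (ψ-maps-into j j∈S) (ψ-maps-into j′ j′∈S)))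
    }

HasComponents-FEdge-transfer :
  ∀ {m₁ m₂} {G₁ : Graph (suc m₁)} {H₁ : HamCycle G₁} {G₂ : Graph (suc m₂)} {H₂ : HamCycle G₂}
    {S₁ : AltCycles H₁} {S₂ : AltCycles H₂} {φ : Fin (suc m₁) → Fin (suc m₂)} →
  OrderIso S₁ S₂ φ → ∃ (T ∘ AltCycles.inS S₁) →
  ∀ {k} → HasComponents (FEdge S₁) k → HasComponents (FEdge S₂) k
HasComponents-FEdge-transfer {m₁} {m₂} {S₁ = S₁} {S₂} {φ} iso (s , s∈S) =
  HasComponents-transfer F₂.Edge-sym Forth.f Back.f Forth.f-hom Back.f-hom back-forth forth-back
  where
  open Inverse iso s
  module Forth = Transport iso (s , s∈S)
  module Back = Transport inverse (φ s , OrderIso.maps-into iso s s∈S)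
  module F₁ = TwoFactor S₁
  module F₂ = TwoFactor S₂

  back-forth : ∀ x → Star F₁.Edge (Back.f (Forth.f x)) x
  back-forth x = subst (λ y → Star F₁.Edge y x) (sym (trans (Back.f-S φe∈S) (cong F₁.v (ψ∘φ e e∈S))))
                       (reverse F₁.Edge-sym (Forth.N₁.walk-to-firstᵛ x))
    where
    e : Fin (suc m₁)
    e = Forth.N₁.firstᵛ x
    e∈S : T (F₁.inS e)
    e∈S = Forth.N₁.first-inS (F₁.v⁻¹ x)
    φe∈S : T (F₂.inS (φ e))
    φe∈S = OrderIso.maps-into iso e e∈S

  forth-back : ∀ y → Star F₂.Edge (Forth.f (Back.f y)) y
  forth-back y = subst (λ x → Star F₂.Edge x y) (sym (trans (Forth.f-S ψe∈S) (cong F₂.v (φ∘ψ e e∈S))))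
                       (reverse F₂.Edge-sym (Back.N₁.walk-to-firstᵛ y))
    where
    e : Fin (suc m₂)
    e = Back.N₁.firstᵛ y
    e∈S : T (F₂.inS e)
    e∈S = Back.N₁.first-inS (F₂.v⁻¹ y)
    ψe∈S : T (F₁.inS (ψ e))
    ψe∈S = ψ-maps-into e e∈S

mainTheorem8 : ∀ {n₁ n₂ : ℕ} {G₁ : Graph n₁} {H₁ : HamCycle G₁} {G₂ : Graph n₂} {H₂ : HamCycle G₂}
                 (S₁ : AltCycles H₁) (S₂ : AltCycles H₂) (φ : Fin n₁ → Fin n₂) →
                 OrderIso S₁ S₂ φ →
                 ∃ λ k → HasComponents (FEdge S₁) k × HasComponents (FEdge S₂) k
mainTheorem8 {zero} {H₁ = H₁} _ _ _ _ with HamCycle.3≤n H₁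
... | ()
mainTheorem8 {suc _} {zero} {H₂ = H₂} _ _ _ _ with HamCycle.3≤n H₂
... | ()
mainTheorem8 {suc _} {suc _} S₁ S₂ φ iso with any? (T? ∘ AltCycles.inS S₁)
... | no S₁-empty =
  1 , F₁.connected-if-S-empty (λ i i∈S → S₁-empty (i , i∈S)) , F₂.connected-if-S-empty S₂-empty
  where
  module F₁ = TwoFactor S₁
  module F₂ = TwoFactor S₂
  S₂-empty : ∀ j → ¬ T (F₂.inS j)
  S₂-empty j j∈S with OrderIso.onto iso j j∈S
  ... | i , i∈S , _ = S₁-empty (i , i∈S)
... | yes S₁-nonempty with components (TwoFactor.Edge? S₁) (TwoFactor.Edge-sym S₁)
... | k , components₁ = k , components₁ , HasComponents-FEdge-transfer iso S₁-nonempty components₁
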